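{- Let $D=(V,A)$ be a digraph and let $G$ be its underlying undirected graph. Then $\gamma_s(G)\le \gamma_{os}(D)$, $\gamma_s(G)\le\gamma_{so}(D)$, $\gamma^+(D)\le\gamma_{os}(D)$, $\gamma^+(D)\le\gamma_{so}(D)$, $\gamma_{os}(D)\le\gamma_{oso}(D)$, $\gamma_{so}(D)\le\gamma_{oso}(D)$ and $\gamma_{so}(D)\le\gamma_{iso}(D)$. Moreover, if $D$ has no pair of opposite arcs (no symmetric arcs), then also $\gamma_{os}(D)\le\gamma_{iso}(D)$.
   Context: Digraphs $D=(V,A)$ are finite, without loops or multiple arcs, but pairs of opposite arcs $uv,vu$ are allowed. $N^+(v)=\{w: vw\in A\}$, $N^-(v)=\{w: wv\in A\}$. The underlying graph $G$ of $D$ is the simple graph on $V$ in which $u,v$ are adjacent iff $uv\in A$ or $vu\in A$. In a graph $G$, $S\subseteq V$ is dominating if every vertex outside $S$ has a neighbor in $S$; $S$ is a secure dominating set if it is dominating and for every $v\in V\setminus S$ there is a neighbor $u\in S$ of $v$ with $(S\setminus\{u\})\cup\{v\}$ dominating; $\gamma_s(G)$ is the minimum size of a secure dominating set. In $D$, $S\subseteq V$ is out-dominating if every $v\in V\setminus S$ has an in-neighbor in $S$; $\gamma^+(D)$ is the minimum size of an out-dominating set. Define: (SODS) $S$ is a secure out-dominating set if $S$ is out-dominating and for every $v\in V\setminus S$ there is $u\in (N^+(v)\cup N^-(v))\cap S$ with $(S\setminus\{u\})\cup\{v\}$ out-dominating; $\gamma_{so}(D)$ is the minimum size of such a set. (OSDS)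 $S$ is an out-secure dominating set if $S$ is dominating in $G$ and for every $v\in V\setminus S$ there is $u\in N^-(v)\cap S$ with $(S\setminus\{u\})\cup\{v\}$ dominating in $G$; $\gamma_{os}(D)$ is the minimum size of such a set. (OSODS) $S$ is an out-secure out-dominating set if $S$ is out-dominating and for every $v\in V\setminus S$ there is $u\in N^-(v)\cap S$ with $(S\setminus\{u\})\cup\{v\}$ out-dominating; $\gamma_{oso}(D)$ is the minimum size of such a set. (ISODS) $S$ is an in-secure out-dominating set if $S$ is out-dominating and for every $v\in V\setminus S$ there is $u\in N^+(v)\cap S$ with $(S\setminus\{u\})\cup\{v\}$ out-dominating; $\gamma_{iso}(D)$ is the minimum size of such a set. -}

module Defs where

open import Data.Nat using (ℕ; _≤_)
open import Data.Bool using (Bool; true; false; _∨_; T)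
open import Data.Bool.Properties using (∨-comm)
open import Data.Fin using (Fin)
open import Data.Fin.Subset using (Subset; _∈_; _∉_; _∪_; _-_; ⁅_⁆; ∣_∣)
open import Data.Product using (Σ; ∃; _×_; _,_)
open import Data.Sum using (_⊎_)
open import Relation.Nullary using (¬_)
open import Relation.Binary.PropositionalEquality using (_≡_; refl)

-- A (finite) digraph on vertex set Fin n: no loops, no multiple arcs
-- (adjacency is a Bool matrix), opposite arcs uv, vu allowed.
record Digraph (n : ℕ) : Set where
  field
    adj      : Fin n → Fin n → Bool
    loopless : ∀ v → adj v v ≡ false

Arc : ∀ {n} → Digraph n → Fin n → Fin n → Set
Arc D u v = T (Digraph.adj D u v)

record Graph (n : ℕ) : Set where
  field
    adj      : Fin n → Fin n → Bool
    symmetric : ∀ u v → adj u v ≡ adj v u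
    loopless : ∀ v → adj v v ≡ false

Edge : ∀ {n} → Graph n → Fin n → Fin n → Set
Edge G u v = T (Graph.adj G u v)

underlying : ∀ {n} → Digraph n → Graph n
underlying {n} D = record
  { adj = λ u v → a u v ∨ a v u
  ; symmetric = λ u v → ∨-comm (a u v) (a v u)
  ; loopless = lp }
  where
  a = Digraph.adj D
  lp : ∀ v → a v v ∨ a v v ≡ false
  lp v rewrite Digraph.loopless D v = refl

swap : ∀ {n} → Subset n → Fin n → Fin n → Subset n
swap S u v = (S - u) ∪ ⁅ v ⁆

Dominating : ∀ {n} → Graph n → Subset n → Set
Dominating G S = ∀ v → v ∉ S → ∃ λ u → u ∈ S × Edge G u v

SecureDominating : ∀ {n} → Graph n → Subset n → Set
SecureDominating G S =
  Dominating G S ×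
  (∀ v → v ∉ S → ∃ λ u → u ∈ S × Edge G u v × Dominating G (swap S u v))

OutDominating : ∀ {n} → Digraph n → Subset n → Set
OutDominating D S = ∀ v → v ∉ S → ∃ λ u → u ∈ S × Arc D u v

_∈N±_ : ∀ {n} {D : Digraph n} → Fin n → Fin n → Set
_∈N±_ {D = D} u v = Arc D v u ⊎ Arc D u v

SecureOutDominating : ∀ {n} → Digraph n → Subset n → Set
SecureOutDominating D S =
  OutDominating D S ×
  (∀ v → v ∉ S → ∃ λ u → u ∈ S × _∈N±_ {D = D} u v × OutDominating D (swap S u v))

OutSecureDominating : ∀ {n} → Digraph n → Subset n → Set
OutSecureDominating D S =
  Dominating (underlying D) S ×
  (∀ v → v ∉ S → ∃ λ u → u ∈ S × Arc D u v × Dominating (underlying D) (swap S u v))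

OutSecureOutDominating : ∀ {n} → Digraph n → Subset n → Set
OutSecureOutDominating D S =
  OutDominating D S ×
  (∀ v → v ∉ S → ∃ λ u → u ∈ S × Arc D u v × OutDominating D (swap S u v))

InSecureOutDominating : ∀ {n} → Digraph n → Subset n → Set
InSecureOutDominating D S =
  OutDominating D S ×
  (∀ v → v ∉ S → ∃ λ u → u ∈ S × Arc D v u × OutDominating D (swap S u v))

IsMinimum : ∀ {n} → (Subset n → Set) → ℕ → Set
IsMinimum {n} P k = (∃ λ (S : Subset n) → P S × ∣ S ∣ ≡ k) × (∀ S → P S → k ≤ ∣ S ∣)

NoSymmetricArcs : ∀ {n} → Digraph n → Set
NoSymmetricArcs D = ∀ u v → Arc D u v → ¬ Arc D v u

module Submission where

open import Defs
open import Data.Nat using (ℕ; _≤_)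
open import Data.Product using (_×_; ∃; _,_; proj₁)
open import Data.Sum using (inj₁; inj₂; [_,_])
open import Data.Bool.Properties using (T-∨)
open import Data.Fin using (Fin; _≟_)
open import Data.Fin.Subset using (Subset; _∈_; _∉_)
open import Data.Fin.Subset.Properties using (x∈p∪q⁺; x∈p∧x∉q⇒x∈p─q; x≢y⇒x∉⁅y⁆; x∈⁅x⁆)
open import Function using (Equivalence; id)
open import Relation.Nullary using (¬_; yes; no)
open import Relation.Binary.PropositionalEquality using (_≡_; refl)

-- Each containment between classes of sets gives the reverse inequality between their minima;
-- the only containment needing an argument is ISODS ⊆ OSDS for digraphs without symmetric arcs.

IsMinimum-antitone : ∀ {n} {P Q : Subset n → Set} {p q : ℕ} →
                     (∀ S → P S → Q S) → IsMinimum P p → IsMinimum Q q → q ≤ p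
IsMinimum-antitone P⊆Q ((S , PS , refl) , _) (_ , minimal) = minimal S (P⊆Q S PS)

∈-swap⁺ˡ : ∀ {n} {S : Subset n} {u v a : Fin n} → a ∈ S → ¬ a ≡ u → a ∈ swap S u v
∈-swap⁺ˡ a∈S a≢u = x∈p∪q⁺ (inj₁ (x∈p∧x∉q⇒x∈p─q a∈S (x≢y⇒x∉⁅y⁆ a≢u)))

∈-swap⁺ʳ : ∀ {n} {S : Subset n} {u v : Fin n} → v ∈ swap S u v
∈-swap⁺ʳ {v = v} = x∈p∪q⁺ (inj₂ (x∈⁅x⁆ v))

-- Every notion of secure domination in Defs is an instance of this one, for a domination
-- notion Dom and a relation R saying which defenders u may move to an attacked vertex v.
Secure : ∀ {n} → (Subset n → Set) → (Fin n → Fin n → Set) → Subset n → Set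
Secure Dom R S = Dom S × (∀ v → v ∉ S → ∃ λ u → u ∈ S × R u v × Dom (swap S u v))

Secure-mono : ∀ {n} {Dom Dom′ : Subset n → Set} {R R′ : Fin n → Fin n → Set} →
              (∀ S → Dom S → Dom′ S) → (∀ {u v} → R u v → R′ u v) →
              ∀ S → Secure Dom R S → Secure Dom′ R′ S
Secure-mono {Dom′ = Dom′} {R′ = R′} Dom⊆Dom′ R⊆R′ S (dom , secure) = Dom⊆Dom′ S dom , defend
  where
  defend : ∀ v → v ∉ S → ∃ λ u → u ∈ S × R′ u v × Dom′ (swap S u v)
  defend v v∉S with secure v v∉S
  ... | u , u∈S , uRv , dom′ = u , u∈S , R⊆R′ uRv , Dom⊆Dom′ (swap S u v) dom′

Secure⇒R-dominating : ∀ {n} {Dom : Subset n → Set} {R : Fin n → Fin n → Set} {S : Subset n} →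
                      Secure Dom R S → ∀ v → v ∉ S → ∃ λ u → u ∈ S × R u v
Secure⇒R-dominating (_ , secure) v v∉S with secure v v∉S
... | u , u∈S , uRv , _ = u , u∈S , uRv

module _ {n} (D : Digraph n) where

  private
    G = underlying D

  arc⇒edge : ∀ {u v} → Arc D u v → Edge G u v
  arc⇒edge uv = Equivalence.from T-∨ (inj₁ uv)

  reverse-arc⇒edge : ∀ {u v} → Arc D v u → Edge G u v
  reverse-arc⇒edge vu = Equivalence.from T-∨ (inj₂ vu)

  N±⇒edge : ∀ {u v} → _∈N±_ {D = D} u v → Edge G u v
  N±⇒edge = [ reverse-arc⇒edge , arc⇒edge ]

  OutDominating⇒Dominating : ∀ S → OutDominating D S → Dominating G S
  OutDominating⇒Dominating S od v v∉S with od v v∉S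
  ... | u , u∈S , uv = u , u∈S , arc⇒edge uv

  OutSecureDominating⇒SecureDominating : ∀ S → OutSecureDominating D S → SecureDominating G S
  OutSecureDominating⇒SecureDominating = Secure-mono {Dom = Dominating G} (λ _ → id) arc⇒edge

  SecureOutDominating⇒SecureDominating : ∀ S → SecureOutDominating D S → SecureDominating G S
  SecureOutDominating⇒SecureDominating = Secure-mono OutDominating⇒Dominating N±⇒edge

  OutSecureDominating⇒OutDominating : ∀ S → OutSecureDominating D S → OutDominating D S
  OutSecureDominating⇒OutDominating _ = Secure⇒R-dominating {Dom = Dominating G}

  SecureOutDominating⇒OutDominating : ∀ S → SecureOutDominating D S → OutDominating D S
  SecureOutDominating⇒OutDominating _ = proj₁

  OutSecureOutDominating⇒OutSecureDominating :
    ∀ S → OutSecureOutDominating D S → OutSecureDominating D S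
  OutSecureOutDominating⇒OutSecureDominating = Secure-mono OutDominating⇒Dominating id

  OutSecureOutDominating⇒SecureOutDominating :
    ∀ S → OutSecureOutDominating D S → SecureOutDominating D S
  OutSecureOutDominating⇒SecureOutDominating = Secure-mono {Dom = OutDominating D} (λ _ → id) inj₂

  InSecureOutDominating⇒SecureOutDominating :
    ∀ S → InSecureOutDominating D S → SecureOutDominating D S
  InSecureOutDominating⇒SecureOutDominating = Secure-mono {Dom = OutDominating D} (λ _ → id) inj₁

  -- After u ∈ S moves along uv, the vertex u is dominated by v, and any other vertex y ∉ S keeps
  -- an in-neighbour in S other than u, or else an out-neighbour in S other than u: that
  -- out-neighbour is not u because uy ∈ A rules out yu ∈ A.
  InSecureOutDominating⇒OutSecureDominating :
    NoSymmetricArcs D → ∀ S → InSecureOutDominating D S → OutSecureDominating D S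
  InSecureOutDominating⇒OutSecureDominating asym S (od , secure) =
    OutDominating⇒Dominating S od , defend
    where
    defend : ∀ v → v ∉ S → ∃ λ u → u ∈ S × Arc D u v × Dominating G (swap S u v)
    defend v v∉S with od v v∉S
    ... | u , u∈S , uv = u , u∈S , uv , dominating
      where
      dominating : Dominating G (swap S u v)
      dominating y y∉swap with y ≟ u
      ... | yes refl = v , ∈-swap⁺ʳ , reverse-arc⇒edge uv
      ... | no y≢u with od y (λ y∈S → y∉swap (∈-swap⁺ˡ y∈S y≢u))
      ...   | b , b∈S , by with b ≟ u
      ...     | no b≢u = b , ∈-swap⁺ˡ b∈S b≢u , arc⇒edge by
      ...     | yes refl with secure y (λ y∈S → y∉swap (∈-swap⁺ˡ y∈S y≢u))
      ...       | c , c∈S , yc , _ =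
                  c , ∈-swap⁺ˡ c∈S (λ { refl → asym _ _ by yc }) , reverse-arc⇒edge yc

proposition1p8 : ∀ {n} (D : Digraph n) (γs γ⁺ γso γos γoso γiso : ℕ) →
    IsMinimum (SecureDominating (underlying D)) γs →
    IsMinimum (OutDominating D) γ⁺ →
    IsMinimum (SecureOutDominating D) γso →
    IsMinimum (OutSecureDominating D) γos →
    IsMinimum (OutSecureOutDominating D) γoso →
    IsMinimum (InSecureOutDominating D) γiso →
    (γs ≤ γos × γs ≤ γso × γ⁺ ≤ γos × γ⁺ ≤ γso ×
    γos ≤ γoso × γso ≤ γoso × γso ≤ γiso) ×
    (NoSymmetricArcs D → γos ≤ γiso)
proposition1p8 D _ _ _ _ _ _ ms m⁺ mso mos moso miso =
  ( IsMinimum-antitone (OutSecureDominating⇒SecureDominating D) mos ms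
  , IsMinimum-antitone (SecureOutDominating⇒SecureDominating D) mso ms
  , IsMinimum-antitone (OutSecureDominating⇒OutDominating D) mos m⁺
  , IsMinimum-antitone (SecureOutDominating⇒OutDominating D) mso m⁺
  , IsMinimum-antitone (OutSecureOutDominating⇒OutSecureDominating D) moso mos
  , IsMinimum-antitone (OutSecureOutDominating⇒SecureOutDominating D) moso mso
  , IsMinimum-antitone (InSecureOutDominating⇒SecureOutDominating D) miso mso )
  , λ asym → IsMinimum-antitone (InSecureOutDominating⇒OutSecureDominating D asym) miso mos
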